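{- Let $c>2$ and let $G$ be a graph of order $cn$. Assume that for every four pairwise disjoint sets of vertices $S_1,S_2,T_1,T_2$ with $|S_1|+|S_2|=|T_1|+|T_2|=|S_1|+|T_1|=|S_2|+|T_2|=n(c-2)/2$, there is at least one edge between $S_1$ and $T_2$ or at least one edge between $S_2$ and $T_1$. Then $G\to P_n$.
   Context: $P_n$ is the path on $n$ vertices. $G\to P_n$ means that every colouring of the edges of $G$ with two colours yields a monochromatic copy of $P_n$. -}

module Defs where

open import Data.Nat using (ℕ; suc; _+_; _*_; _<_)
open import Data.Fin using (Fin; toℕ)
open import Data.Fin.Subset using (Subset; _∈_; _∉_; ∣_∣)
open import Data.Bool using (Bool)
open import Data.Product using (Σ; ∃; _×_)
open import Relation.Binary.PropositionalEquality using (_≡_)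
open import Relation.Nullary using (¬_)
open import Function.Definitions using (Injective)

record Graph (N : ℕ) : Set₁ where
  field
    Adj   : Fin N → Fin N → Set
    sym   : ∀ {u v} → Adj u v → Adj v u
    irrefl : ∀ {u} → ¬ Adj u u
open Graph public

-- A 2-colouring of the edges (colours = Bool); given on all pairs,
-- symmetric, only its values on edges matter.
record Colouring {N : ℕ} (G : Graph N) : Set where
  field
    col    : Fin N → Fin N → Bool
    colSym : ∀ u v → col u v ≡ col v u
open Colouring public

MonoPath : {N : ℕ} (G : Graph N) → Colouring G → Bool → ℕ → Set
MonoPath {N} G χ b n =
  Σ (Fin n → Fin N) λ p →
    Injective _≡_ _≡_ p ×
    (∀ (i j : Fin n) → toℕ j ≡ suc (toℕ i) →
       Adj G (p i) (p j) × col χ (p i) (p j) ≡ b)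

Arrows : {N : ℕ} → Graph N → ℕ → Set
Arrows G n = ∀ (χ : Colouring G) → ∃ λ b → MonoPath G χ b n

Disjoint : {N : ℕ} → Subset N → Subset N → Set
Disjoint {N} S T = ∀ (x : Fin N) → x ∈ S → x ∉ T

EdgeBetween : {N : ℕ} → Graph N → Subset N → Subset N → Set
EdgeBetween {N} G S T = Σ (Fin N) λ u → Σ (Fin N) λ v → u ∈ S × v ∈ T × Adj G u v

-- Depth-first search on the red graph either finds a red P_n or stops with two
-- sets A, B of equal size, no red edge between them, and fewer than n vertices
-- on its stack. Depth-first search on the blue edges between A and B then either
-- finds a blue P_n or splits A ∪ B into P, Q of equal size L > m with no blue edge
-- between them, leaving k < n vertices on the stack, so that 2|A| = 2|B| = 2L + k.
-- The stack is a blue path, so it alternates between A and B and at most (k + 1)/2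
-- of its vertices lie in A; hence |P ∩ A| + |Q ∩ A| ≥ L, and likewise
-- |P ∖ A| + |Q ∖ A| ≥ L. These four cells therefore contain a balanced quadruple,
-- and the hypothesis yields an edge from P ∩ A to Q ∖ A or from Q ∩ A to P ∖ A.
-- Such an edge joins A to B, so it is not red, and joins P to Q, so it is not blue.

module Submission where

open import Defs renaming (sym to Adj-sym)
open import Data.Bool using (Bool; true; false)
import Data.Bool as Bool
open import Data.Fin using (Fin; zero; suc; toℕ)
open import Data.Fin.Properties using (any?; all?) renaming (_≟_ to _≟ᶠ_)
open import Data.Fin.Subset
  using (Subset; inside; outside; _∈_; _∉_; _⊆_; ∣_∣; ⊥; ⊤; ⁅_⁆; _∩_; _∪_; _─_; _-_; Empty)
open import Data.Fin.Subset.Properties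
open import Data.Maybe using (Maybe; just; nothing)
import Data.Maybe.Properties as Maybe
open import Data.Nat using (ℕ; zero; suc; _+_; _*_; _∸_; _≤_; _<_; z≤n; s≤s; s≤s⁻¹; _≤?_)
open import Data.Nat.Properties
open import Data.Product using (Σ; ∃; ∃₂; _×_; _,_; proj₁; proj₂; uncurry; swap)
import Data.Product.Properties as Product
open import Data.Sum using (_⊎_; inj₁; inj₂; [_,_]′)
import Data.Sum as Sum
open import Data.Vec.Base using (Vec; []; _∷_; lookup)
import Data.Vec.Base as Vec
open import Data.Vec.Membership.Propositional using () renaming (_∈_ to _∈ᵥ_)
open import Data.Vec.Relation.Unary.All as All using (All; []; _∷_)
open import Data.Vec.Relation.Unary.AllPairs as AllPairs using ([]; _∷_)
open import Data.Vec.Relation.Unary.Any using (here; there)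
open import Data.Vec.Relation.Unary.Linked as Linked using (Linked; []; [-]; _∷_)
open import Data.Vec.Relation.Unary.Unique.Propositional using (Unique)
open import Data.Vec.Relation.Unary.Unique.Propositional.Properties using (lookup-injective)
open import Function using (id; _∘_; flip; case_of_)
open import Level using (0ℓ)
open import Relation.Binary using (Rel; Decidable; Symmetric)
open import Relation.Binary.PropositionalEquality
open import Relation.Nullary using (Dec; yes; no; ¬_; contradiction; _×-dec_; _⊎-dec_; _→-dec_; ¬?)

private
  variable
    N : ℕ
    x y : Fin N
    p q r : Subset N

-- Counting in finite subsets

x∈p─q⇒x∉q : x ∈ p ─ q → x ∉ q
x∈p─q⇒x∉q {p = _ ∷ p} {q = inside ∷ q} (Vec.there x∈p─q) (Vec.there x∈q) = x∈p─q⇒x∉q x∈p─q x∈q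
x∈p─q⇒x∉q {p = _ ∷ p} {q = outside ∷ q} (Vec.there x∈p─q) (Vec.there x∈q) = x∈p─q⇒x∉q x∈p─q x∈q

x∈p─q⁻ : ∀ (p q : Subset N) → x ∈ p ─ q → x ∈ p × x ∉ q
x∈p─q⁻ p q x∈p─q = p─q⊆p p q x∈p─q , x∈p─q⇒x∉q x∈p─q

∣p∣≡∣p∩q∣+∣p─q∣ : ∀ (p q : Subset N) → ∣ p ∣ ≡ ∣ p ∩ q ∣ + ∣ p ─ q ∣
∣p∣≡∣p∩q∣+∣p─q∣ []            []            = refl
∣p∣≡∣p∩q∣+∣p─q∣ (inside  ∷ p) (inside  ∷ q) = cong suc (∣p∣≡∣p∩q∣+∣p─q∣ p q)
∣p∣≡∣p∩q∣+∣p─q∣ (inside  ∷ p) (outside ∷ q) =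
  trans (cong suc (∣p∣≡∣p∩q∣+∣p─q∣ p q)) (sym (+-suc ∣ p ∩ q ∣ ∣ p ─ q ∣))
∣p∣≡∣p∩q∣+∣p─q∣ (outside ∷ p) (inside  ∷ q) = ∣p∣≡∣p∩q∣+∣p─q∣ p q
∣p∣≡∣p∩q∣+∣p─q∣ (outside ∷ p) (outside ∷ q) = ∣p∣≡∣p∩q∣+∣p─q∣ p q

x∈p⇒suc∣p-x∣≡∣p∣ : x ∈ p → suc ∣ p - x ∣ ≡ ∣ p ∣
x∈p⇒suc∣p-x∣≡∣p∣ {p = inside ∷ p} Vec.here = cong (suc ∘ ∣_∣) (p─⊥≡p p)
x∈p⇒suc∣p-x∣≡∣p∣ {p = inside  ∷ p} (Vec.there x∈p) = cong suc (x∈p⇒suc∣p-x∣≡∣p∣ x∈p)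
x∈p⇒suc∣p-x∣≡∣p∣ {p = outside ∷ p} (Vec.there x∈p) = x∈p⇒suc∣p-x∣≡∣p∣ x∈p

x∉p⇒∣p∪⁅x⁆∣≡suc∣p∣ : x ∉ p → ∣ p ∪ ⁅ x ⁆ ∣ ≡ suc ∣ p ∣
x∉p⇒∣p∪⁅x⁆∣≡suc∣p∣ {x = zero}  {p = inside  ∷ p} x∉p = contradiction Vec.here x∉p
x∉p⇒∣p∪⁅x⁆∣≡suc∣p∣ {x = zero}  {p = outside ∷ p} x∉p = cong (suc ∘ ∣_∣) (∪-identityʳ p)
x∉p⇒∣p∪⁅x⁆∣≡suc∣p∣ {x = suc x} {p = inside  ∷ p} x∉p = cong suc (x∉p⇒∣p∪⁅x⁆∣≡suc∣p∣ (x∉p ∘ Vec.there))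
x∉p⇒∣p∪⁅x⁆∣≡suc∣p∣ {x = suc x} {p = outside ∷ p} x∉p = x∉p⇒∣p∪⁅x⁆∣≡suc∣p∣ (x∉p ∘ Vec.there)

∣p∣≤suc∣p-x∣ : ∀ (p : Subset N) x → ∣ p ∣ ≤ suc ∣ p - x ∣
∣p∣≤suc∣p-x∣ p x = begin
  ∣ p ∣                         ≡⟨ ∣p∣≡∣p∩q∣+∣p─q∣ p ⁅ x ⁆ ⟩
  ∣ p ∩ ⁅ x ⁆ ∣ + ∣ p - x ∣     ≤⟨ +-monoˡ-≤ _ (∣p∩q∣≤∣q∣ p ⁅ x ⁆) ⟩
  ∣ ⁅ x ⁆ ∣ + ∣ p - x ∣         ≡⟨ cong (_+ ∣ p - x ∣) (∣⁅x⁆∣≡1 x) ⟩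
  suc ∣ p - x ∣                 ∎
  where open ≤-Reasoning

∣r∣≤∣r∩p∣+∣r∩q∣+∣r─p─q∣ : ∀ (r p q : Subset N) → ∣ r ∣ ≤ ∣ r ∩ p ∣ + ∣ r ∩ q ∣ + ∣ r ─ p ─ q ∣
∣r∣≤∣r∩p∣+∣r∩q∣+∣r─p─q∣ r p q = begin
  ∣ r ∣                                         ≡⟨ ∣p∣≡∣p∩q∣+∣p─q∣ r p ⟩
  ∣ r ∩ p ∣ + ∣ r ─ p ∣                         ≡⟨ cong (∣ r ∩ p ∣ +_) (∣p∣≡∣p∩q∣+∣p─q∣ (r ─ p) q) ⟩
  ∣ r ∩ p ∣ + (∣ (r ─ p) ∩ q ∣ + ∣ r ─ p ─ q ∣)   ≤⟨ +-monoʳ-≤ ∣ r ∩ p ∣ (+-monoˡ-≤ _ [r─p]∩q≤r∩q) ⟩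
  ∣ r ∩ p ∣ + (∣ r ∩ q ∣ + ∣ r ─ p ─ q ∣)       ≡⟨ +-assoc ∣ r ∩ p ∣ _ _ ⟨
  ∣ r ∩ p ∣ + ∣ r ∩ q ∣ + ∣ r ─ p ─ q ∣         ∎
  where
  open ≤-Reasoning
  [r─p]∩q≤r∩q : ∣ (r ─ p) ∩ q ∣ ≤ ∣ r ∩ q ∣
  [r─p]∩q≤r∩q = p⊆q⇒∣p∣≤∣q∣ λ x∈ → let x∈r─p , x∈q = x∈p∩q⁻ (r ─ p) q x∈
                                 in x∈p∩q⁺ (p─q⊆p r p x∈r─p , x∈q)

x∈p∪⁅y⁆⇒x∈p⊎x≡y : x ∈ p ∪ ⁅ y ⁆ → x ∈ p ⊎ x ≡ y
x∈p∪⁅y⁆⇒x∈p⊎x≡y {p = p} {y = y} x∈p∪y = Sum.map₂ (x∈⁅y⁆⇒x≡y y) (x∈p∪q⁻ p ⁅ y ⁆ x∈p∪y)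

Disjoint⇒∣p∪q∣≡∣p∣+∣q∣ : Disjoint p q → ∣ p ∪ q ∣ ≡ ∣ p ∣ + ∣ q ∣
Disjoint⇒∣p∪q∣≡∣p∣+∣q∣ {p = []} {q = []} _ = refl
Disjoint⇒∣p∪q∣≡∣p∣+∣q∣ {p = inside ∷ p} {q = inside ∷ q} p∩q = contradiction Vec.here (p∩q zero Vec.here)
Disjoint⇒∣p∪q∣≡∣p∣+∣q∣ {p = inside ∷ p} {q = outside ∷ q} p∩q =
  cong suc (Disjoint⇒∣p∪q∣≡∣p∣+∣q∣ λ x x∈p x∈q → p∩q (suc x) (Vec.there x∈p) (Vec.there x∈q))
Disjoint⇒∣p∪q∣≡∣p∣+∣q∣ {p = outside ∷ p} {q = inside ∷ q} p∩q =
  trans (cong suc (Disjoint⇒∣p∪q∣≡∣p∣+∣q∣ λ x x∈p x∈q → p∩q (suc x) (Vec.there x∈p) (Vec.there x∈q)))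
        (sym (+-suc ∣ p ∣ ∣ q ∣))
Disjoint⇒∣p∪q∣≡∣p∣+∣q∣ {p = outside ∷ p} {q = outside ∷ q} p∩q =
  Disjoint⇒∣p∪q∣≡∣p∣+∣q∣ λ x x∈p x∈q → p∩q (suc x) (Vec.there x∈p) (Vec.there x∈q)

Empty⇒∣p∣≡0 : Empty p → ∣ p ∣ ≡ 0
Empty⇒∣p∣≡0 {N} p-empty = trans (cong ∣_∣ (Empty-unique p-empty)) (∣⊥∣≡0 N)

subset-of-size : ∀ (p : Subset N) {a} → a ≤ ∣ p ∣ → ∃ λ q → q ⊆ p × ∣ q ∣ ≡ a
subset-of-size {N} p {zero} _ = ⊥ , ⊥⊆ , ∣⊥∣≡0 N
subset-of-size (inside ∷ p) {suc a} a<∣p∣ =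
  let q , q⊆p , ∣q∣≡a = subset-of-size p (≤-pred a<∣p∣) in inside ∷ q , s⊆s q⊆p , cong suc ∣q∣≡a
subset-of-size (outside ∷ p) {suc a} a<∣p∣ =
  let q , q⊆p , ∣q∣≡a = subset-of-size p a<∣p∣ in outside ∷ q , s⊆s q⊆p , ∣q∣≡a

-- Paths and depth-first search

record Path {N} (R : Rel (Fin N) 0ℓ) (n : ℕ) : Set where
  field
    vertices : Vec (Fin N) n
    linked   : Linked R vertices
    unique   : Unique vertices

Linked⇒lookup-suc : ∀ {A : Set} {R : Rel A 0ℓ} {n} {xs : Vec A n} → Linked R xs →
  ∀ (i j : Fin n) → toℕ j ≡ suc (toℕ i) → R (lookup xs i) (lookup xs j)
Linked⇒lookup-suc {xs = _ ∷ _ ∷ _} (r ∷ _) zero (suc zero) _ = r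
Linked⇒lookup-suc (_ ∷ l) (suc i) (suc j) j≡1+i = Linked⇒lookup-suc l i j (suc-injective j≡1+i)
Linked⇒lookup-suc _ zero    zero          ()
Linked⇒lookup-suc _ zero    (suc (suc _)) ()
Linked⇒lookup-suc _ (suc _) zero          ()

Path⇒MonoPath : {G : Graph N} (χ : Colouring G) {b : Bool} {R : Rel (Fin N) 0ℓ} →
  (∀ {u v} → R u v → Adj G u v × col χ u v ≡ b) → ∀ {n} → Path R n → MonoPath G χ b n
Path⇒MonoPath χ R⇒b-edge P =
  lookup vertices , lookup-injective unique _ _ , λ i j j≡1+i → R⇒b-edge (Linked⇒lookup-suc linked i j j≡1+i)
  where open Path P

module DepthFirstSearch (W : Subset N) {R : Rel (Fin N) 0ℓ} (R? : Decidable R) (R-sym : Symmetric R) where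

  -- S holds the finished vertices, T the unvisited ones, and path the stack, top first.
  record State {k} (path : Vec (Fin N) k) : Set where
    field
      S T         : Subset N
      S⊆W         : S ⊆ W
      T⊆W         : T ⊆ W
      S#T         : Disjoint S T
      no-edge     : ∀ {s t} → s ∈ S → t ∈ T → ¬ R s t
      path⊆W      : All (_∈ W) path
      path#S      : All (_∉ S) path
      path#T      : All (_∉ T) path
      linked      : Linked R path
      unique      : Unique path
      covers      : ∀ {x} → x ∈ W → x ∈ S ⊎ x ∈ T ⊎ x ∈ᵥ path
      size        : ∣ S ∣ + ∣ T ∣ + k ≡ ∣ W ∣

  record Separation (n : ℕ) : Set where
    field
      {k}      : ℕ
      {path}   : Vec (Fin N) k
      state    : State path
      balanced : ∣ State.S state ∣ ≡ ∣ State.T state ∣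
      short    : k < n
    open State state public

  start : State []
  start = record
    { S = ⊥ ; T = W ; S⊆W = ⊥⊆ ; T⊆W = λ x∈W → x∈W
    ; S#T = λ _ x∈⊥ → contradiction x∈⊥ ∉⊥ ; no-edge = λ s∈⊥ → contradiction s∈⊥ ∉⊥
    ; path⊆W = [] ; path#S = [] ; path#T = [] ; linked = [] ; unique = []
    ; covers = λ x∈W → inj₂ (inj₁ x∈W)
    ; size = trans (+-identityʳ _) (cong (_+ ∣ W ∣) (∣⊥∣≡0 N)) }

  push : ∀ {k v} {U : Vec (Fin N) k} → (st : State U) → v ∈ State.T st → Linked R (v ∷ U) → State (v ∷ U)
  push {k} {v} {U} st v∈T v∷U-linked = record
    { S = S ; T = T - v ; S⊆W = S⊆W ; T⊆W = T⊆W ∘ p─q⊆p T ⁅ v ⁆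
    ; S#T = λ x x∈S x∈T-v → S#T x x∈S (p─q⊆p T ⁅ v ⁆ x∈T-v)
    ; no-edge = λ s∈S t∈T-v → no-edge s∈S (p─q⊆p T ⁅ v ⁆ t∈T-v)
    ; path⊆W = T⊆W v∈T ∷ path⊆W
    ; path#S = (λ v∈S → S#T v v∈S v∈T) ∷ path#S
    ; path#T = (λ v∈T-v → x∈p─q⇒x∉q v∈T-v (x∈⁅x⁆ v)) ∷ All.map (λ u∉T u∈T-v → u∉T (p─q⊆p T ⁅ v ⁆ u∈T-v)) path#T
    ; linked = v∷U-linked
    ; unique = All.map (λ u∉T v≡u → u∉T (subst (_∈ T) v≡u v∈T)) path#T ∷ unique
    ; covers = covers′
    ; size = begin
        ∣ S ∣ + ∣ T - v ∣ + suc k   ≡⟨ +-suc (∣ S ∣ + ∣ T - v ∣) k ⟩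
        suc (∣ S ∣ + ∣ T - v ∣) + k ≡⟨ cong (_+ k) (+-suc ∣ S ∣ ∣ T - v ∣) ⟨
        ∣ S ∣ + suc ∣ T - v ∣ + k   ≡⟨ cong (λ t → ∣ S ∣ + t + k) (x∈p⇒suc∣p-x∣≡∣p∣ v∈T) ⟩
        ∣ S ∣ + ∣ T ∣ + k           ≡⟨ size ⟩
        ∣ W ∣                       ∎ }
    where
    open State st
    open ≡-Reasoning
    covers′ : ∀ {x} → x ∈ W → x ∈ S ⊎ x ∈ T - v ⊎ x ∈ᵥ v ∷ U
    covers′ {x} x∈W with covers x∈W
    ... | inj₁ x∈S = inj₁ x∈S
    ... | inj₂ (inj₂ x∈U) = inj₂ (inj₂ (there x∈U))
    ... | inj₂ (inj₁ x∈T) with x ≟ᶠ v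
    ...   | yes x≡v = inj₂ (inj₂ (here x≡v))
    ...   | no x≢v  = inj₂ (inj₁ (x∈p∧x≢y⇒x∈p-y x∈T x≢v))

  pop : ∀ {k u} {U : Vec (Fin N) k} → (st : State (u ∷ U)) → (∀ {t} → t ∈ State.T st → ¬ R u t) → State U
  pop {k} {u} {U} st u-stuck = record
    { S = S ∪ ⁅ u ⁆ ; T = T
    ; S⊆W = [ S⊆W , (λ { refl → u∈W }) ]′ ∘ x∈p∪⁅y⁆⇒x∈p⊎x≡y
    ; T⊆W = T⊆W
    ; S#T = λ x x∈S∪u → [ S#T x , (λ { refl → u∉T }) ]′ (x∈p∪⁅y⁆⇒x∈p⊎x≡y x∈S∪u)
    ; no-edge = λ s∈S∪u t∈T → [ (λ s∈S → no-edge s∈S t∈T) , (λ { refl → u-stuck t∈T }) ]′ (x∈p∪⁅y⁆⇒x∈p⊎x≡y s∈S∪u)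
    ; path⊆W = All.tail path⊆W
    ; path#S = All.map (λ (x∉S , u≢x) → [ x∉S , u≢x ∘ sym ]′ ∘ x∈p∪⁅y⁆⇒x∈p⊎x≡y)
                       (All.zip (All.tail path#S , AllPairs.head unique))
    ; path#T = All.tail path#T
    ; linked = Linked.tail linked
    ; unique = AllPairs.tail unique
    ; covers = covers′
    ; size = begin
        ∣ S ∪ ⁅ u ⁆ ∣ + ∣ T ∣ + k ≡⟨ cong (λ s → s + ∣ T ∣ + k) (x∉p⇒∣p∪⁅x⁆∣≡suc∣p∣ (All.head path#S)) ⟩
        suc (∣ S ∣ + ∣ T ∣) + k   ≡⟨ +-suc (∣ S ∣ + ∣ T ∣) k ⟨
        ∣ S ∣ + ∣ T ∣ + suc k     ≡⟨ size ⟩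
        ∣ W ∣                     ∎ }
    where
    open State st
    open ≡-Reasoning
    u∈W = All.head path⊆W
    u∉T = All.head path#T
    covers′ : ∀ {x} → x ∈ W → x ∈ S ∪ ⁅ u ⁆ ⊎ x ∈ T ⊎ x ∈ᵥ U
    covers′ x∈W with covers x∈W
    ... | inj₁ x∈S = inj₁ (x∈p∪q⁺ (inj₁ x∈S))
    ... | inj₂ (inj₁ x∈T) = inj₂ (inj₁ x∈T)
    ... | inj₂ (inj₂ (here refl)) = inj₁ (x∈p∪q⁺ (inj₂ (x∈⁅x⁆ u)))
    ... | inj₂ (inj₂ (there x∈U)) = inj₂ (inj₂ x∈U)

  -- The fuel g is ∣T∣ − ∣S∣: each push and each pop lowers it by one.
  mutual
    search : ∀ n g {k} {U : Vec (Fin N) k} (st : State U) → ∣ State.T st ∣ ≡ g + ∣ State.S st ∣ → k < n →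
             Path R n ⊎ Separation n
    search n zero st T≡S k<n = inj₂ record { state = st ; balanced = sym T≡S ; short = k<n }
    search n (suc g) {U = []} st T≡S k<n with nonempty? (State.T st)
    ... | yes (v , v∈T) = extend n g st v∈T [-] T≡S k<n
    ... | no T-empty    = contradiction (trans (sym T≡S) (Empty⇒∣p∣≡0 T-empty)) λ ()
    search n (suc g) {U = u ∷ U} st T≡S k<n with any? (λ t → t ∈? State.T st ×-dec R? u t)
    ... | yes (v , v∈T , Ruv) = extend n g st v∈T (R-sym Ruv ∷ State.linked st) T≡S k<n
    ... | no u-stuck = search n g (pop st λ t∈T Rut → u-stuck (_ , t∈T , Rut)) T≡S′ (<-trans (n<1+n _) k<n)
      where
      open State st
      T≡S′ : ∣ T ∣ ≡ g + ∣ S ∪ ⁅ u ⁆ ∣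
      T≡S′ = trans T≡S (trans (sym (+-suc g ∣ S ∣)) (cong (g +_) (sym (x∉p⇒∣p∪⁅x⁆∣≡suc∣p∣ (All.head path#S)))))

    extend : ∀ n g {k v} {U : Vec (Fin N) k} (st : State U) → v ∈ State.T st → Linked R (v ∷ U) →
             ∣ State.T st ∣ ≡ suc g + ∣ State.S st ∣ → k < n → Path R n ⊎ Separation n
    extend n g {k} st v∈T v∷U-linked T≡S k<n with suc k ≟ n
    ... | yes refl = inj₁ record { vertices = _ ; linked = State.linked st′ ; unique = State.unique st′ }
      where st′ = push st v∈T v∷U-linked
    ... | no k+1≢n = search n g (push st v∈T v∷U-linked) (suc-injective (trans (x∈p⇒suc∣p-x∣≡∣p∣ v∈T) T≡S))
                       (≤∧≢⇒< k<n k+1≢n)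

  dfs : ∀ n → Path R n ⊎ Separation n
  dfs zero    = inj₁ record { vertices = [] ; linked = [] ; unique = [] }
  dfs (suc n) = search (suc n) ∣ W ∣ start (sym (trans (cong (∣ W ∣ +_) (∣⊥∣≡0 N)) (+-identityʳ _))) (s≤s z≤n)

module _ {R : Rel (Fin N) 0ℓ} (A : Subset N) (R-leaves-A : ∀ {x y} → R x y → x ∈ A → y ∉ A) where

  OnPath : ∀ {k} → Subset N → Vec (Fin N) k → Set
  OnPath p U = ∀ {x} → x ∈ p → x ∈ A × x ∈ᵥ U

  private
    OnPath-tail : ∀ {k u} {U : Vec (Fin N) k} (p : Subset N) → OnPath p (u ∷ U) → OnPath (p - u) U
    OnPath-tail {u = u} p p-on-u∷U x∈p-u with p-on-u∷U (p─q⊆p p ⁅ u ⁆ x∈p-u)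
    ... | x∈A , here refl   = contradiction (x∈⁅x⁆ u) (x∈p─q⇒x∉q x∈p-u)
    ... | x∈A , there x∈U   = x∈A , x∈U

    2∣p∣≤2+2∣p-u∣ : ∀ (p : Subset N) u → 2 * ∣ p ∣ ≤ 2 + 2 * ∣ p - u ∣
    2∣p∣≤2+2∣p-u∣ p u = ≤-trans (*-monoʳ-≤ 2 (∣p∣≤suc∣p-x∣ p u)) (≤-reflexive (*-suc 2 ∣ p - u ∣))

    2∣p∣≤2∣p-u∣ : ∀ {k u} {U : Vec (Fin N) k} (p : Subset N) → OnPath p (u ∷ U) → u ∉ A → 2 * ∣ p ∣ ≤ 2 * ∣ p - u ∣
    2∣p∣≤2∣p-u∣ {u = u} p p-on-path u∉A = *-monoʳ-≤ 2 (p⊆q⇒∣p∣≤∣q∣ {p = p} {q = p - u} λ x∈p →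
      x∈p∧x≢y⇒x∈p-y x∈p λ { refl → u∉A (proj₁ (p-on-path x∈p)) })

    -- The second component, for paths starting outside A, carries the induction.
    alternating-bound : ∀ {k u} {U : Vec (Fin N) k} → Linked R (u ∷ U) → ∀ (p : Subset N) → OnPath p (u ∷ U) →
      2 * ∣ p ∣ ≤ 2 + k × (u ∉ A → 2 * ∣ p ∣ ≤ 1 + k)
    alternating-bound {u = u} {U = []} _ p p-on-path =
      ≤-trans (2∣p∣≤2+2∣p-u∣ p u) (≤-reflexive (cong (λ s → 2 + 2 * s) ∣p-u∣≡0)) ,
      λ u∉A → ≤-trans (2∣p∣≤2∣p-u∣ p p-on-path u∉A) (≤-trans (≤-reflexive (cong (2 *_) ∣p-u∣≡0)) z≤n)
      where
      ∣p-u∣≡0 : ∣ p - u ∣ ≡ 0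
      ∣p-u∣≡0 = Empty⇒∣p∣≡0 λ (_ , x∈p-u) → case proj₂ (OnPath-tail p p-on-path x∈p-u) of λ ()
    alternating-bound {k = suc k} {u = u} {U = v ∷ U} (Ruv ∷ v∷U-linked) p p-on-path
      with alternating-bound v∷U-linked (p - u) (OnPath-tail p p-on-path) | u ∈? A
    ... | _ , bound-if-v∉A | yes u∈A =
          ≤-trans (2∣p∣≤2+2∣p-u∣ p u) (+-monoʳ-≤ 2 (bound-if-v∉A (R-leaves-A Ruv u∈A))) ,
          λ u∉A → contradiction u∈A u∉A
    ... | bound , _ | no u∉A = m≤n⇒m≤1+n bound′ , λ _ → bound′
      where
      bound′ : 2 * ∣ p ∣ ≤ 1 + suc k
      bound′ = ≤-trans (2∣p∣≤2∣p-u∣ p p-on-path u∉A) bound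

  alternating-path-bound : ∀ {k} {U : Vec (Fin N) k} → Linked R U →
    ∀ (p : Subset N) → OnPath p U → 2 * ∣ p ∣ ≤ suc k
  alternating-path-bound {U = []} _ p p-on-path =
    ≤-trans (≤-reflexive (cong (2 *_) (Empty⇒∣p∣≡0 λ (_ , x∈p) → case proj₂ (p-on-path x∈p) of λ ()))) z≤n
  alternating-path-bound {U = _ ∷ _} U-linked p p-on-path = proj₁ (alternating-bound U-linked p p-on-path)

-- Balanced quadruples

Meets : Rel (Fin N) 0ℓ → Subset N → Subset N → Set
Meets {N} R S T = Σ (Fin N) λ u → Σ (Fin N) λ v → u ∈ S × v ∈ T × R u v

Meets-map : ∀ {R R′ : Rel (Fin N) 0ℓ} {S S′ T T′} → (∀ {u v} → R u v → R′ u v) → S ⊆ S′ → T ⊆ T′ →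
  Meets R S T → Meets R′ S′ T′
Meets-map R⇒R′ S⊆S′ T⊆T′ (u , v , u∈S , v∈T , Ruv) = u , v , S⊆S′ u∈S , T⊆T′ v∈T , R⇒R′ Ruv

BalancedQuadruple : ℕ → (S₁ S₂ T₁ T₂ : Subset N) → Set
BalancedQuadruple m S₁ S₂ T₁ T₂ =
  Disjoint S₁ S₂ × Disjoint S₁ T₁ × Disjoint S₁ T₂ × Disjoint S₂ T₁ × Disjoint S₂ T₂ × Disjoint T₁ T₂ ×
  ∣ S₁ ∣ + ∣ S₂ ∣ ≡ m × ∣ T₁ ∣ + ∣ T₂ ∣ ≡ m × ∣ S₁ ∣ + ∣ T₁ ∣ ≡ m × ∣ S₂ ∣ + ∣ T₂ ∣ ≡ m

LinksQuadruples : ℕ → Rel (Fin N) 0ℓ → Set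
LinksQuadruples {N} m R =
  ∀ (S₁ S₂ T₁ T₂ : Subset N) → BalancedQuadruple m S₁ S₂ T₁ T₂ → Meets R S₁ T₂ ⊎ Meets R S₂ T₁

Disjoint-⊆ : ∀ {S S′ T T′ : Subset N} → S′ ⊆ S → T′ ⊆ T → Disjoint S T → Disjoint S′ T′
Disjoint-⊆ S′⊆S T′⊆T S#T x x∈S′ x∈T′ = S#T x (S′⊆S x∈S′) (T′⊆T x∈T′)

Disjoint-sym : ∀ {S T : Subset N} → Disjoint S T → Disjoint T S
Disjoint-sym S#T x x∈T x∈S = S#T x x∈S x∈T

Disjoint-∩─ : ∀ (p q A : Subset N) → Disjoint (p ∩ A) (q ─ A)
Disjoint-∩─ p q A x x∈p∩A x∈q─A = x∈p─q⇒x∉q x∈q─A (proj₂ (x∈p∩q⁻ p A x∈p∩A))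

complement-within : ∀ {m a y z} → a ≤ m → m ≤ a + y → m ≤ a + z → ∃ λ b → a + b ≡ m × b ≤ y × b ≤ z
complement-within {m} {a} a≤m m≤a+y m≤a+z = m ∸ a , m+[n∸m]≡n a≤m , m≤n+o⇒m∸n≤o m a m≤a+y , m≤n+o⇒m∸n≤o m a m≤a+z

balanced-split : ∀ {m x y z w} → m ≤ x + z → m ≤ y + w → m ≤ x + y → m ≤ z + w →
  ∃₂ λ a b → a + b ≡ m × a ≤ x × a ≤ w × b ≤ y × b ≤ z
balanced-split {m} {x} {y} {z} {w} m≤x+z m≤y+w m≤x+y m≤z+w with x ≤? w | m ≤? x | m ≤? w
... | yes x≤w | yes m≤x | _ = m , 0 , +-identityʳ m , m≤x , ≤-trans m≤x x≤w , z≤n , z≤n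
... | yes x≤w | no m≰x  | _ = let b , x+b≡m , b≤y , b≤z = complement-within (<⇒≤ (≰⇒> m≰x)) m≤x+y m≤x+z
                              in x , b , x+b≡m , ≤-refl , x≤w , b≤y , b≤z
... | no x≰w  | _ | yes m≤w = m , 0 , +-identityʳ m , ≤-trans m≤w (<⇒≤ (≰⇒> x≰w)) , m≤w , z≤n , z≤n
... | no x≰w  | _ | no m≰w  =
  let b , w+b≡m , b≤y , b≤z = complement-within (<⇒≤ (≰⇒> m≰w))
                                (subst (m ≤_) (+-comm y w) m≤y+w) (subst (m ≤_) (+-comm z w) m≤z+w)
  in w , b , w+b≡m , <⇒≤ (≰⇒> x≰w) , ≤-refl , b≤y , b≤z

grid-balanced : ∀ {P Q : Subset N} (A : Subset N) {S₁ S₂ T₁ T₂ : Subset N} {a b m} → Disjoint P Q → a + b ≡ m →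
  S₁ ⊆ P ∩ A → S₂ ⊆ Q ∩ A → T₁ ⊆ P ─ A → T₂ ⊆ Q ─ A →
  ∣ S₁ ∣ ≡ a → ∣ S₂ ∣ ≡ b → ∣ T₁ ∣ ≡ b → ∣ T₂ ∣ ≡ a → BalancedQuadruple m S₁ S₂ T₁ T₂
grid-balanced {P = P} {Q} A {S₁} {S₂} {T₁} {T₂} {a} {b} P#Q a+b≡m S₁⊆ S₂⊆ T₁⊆ T₂⊆ ∣S₁∣≡a ∣S₂∣≡b ∣T₁∣≡b ∣T₂∣≡a =
  Disjoint-⊆ S₁⊆P S₂⊆Q P#Q , Disjoint-⊆ S₁⊆ T₁⊆ (Disjoint-∩─ P P A) , Disjoint-⊆ S₁⊆P T₂⊆Q P#Q ,
  Disjoint-⊆ S₂⊆Q T₁⊆P (Disjoint-sym P#Q) , Disjoint-⊆ S₂⊆ T₂⊆ (Disjoint-∩─ Q Q A) , Disjoint-⊆ T₁⊆P T₂⊆Q P#Q ,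
  trans (cong₂ _+_ ∣S₁∣≡a ∣S₂∣≡b) a+b≡m , trans (cong₂ _+_ ∣T₁∣≡b ∣T₂∣≡a) b+a≡m ,
  trans (cong₂ _+_ ∣S₁∣≡a ∣T₁∣≡b) a+b≡m , trans (cong₂ _+_ ∣S₂∣≡b ∣T₂∣≡a) b+a≡m
  where
  b+a≡m = trans (+-comm b a) a+b≡m
  S₁⊆P : S₁ ⊆ P
  S₁⊆P = p∩q⊆p P A ∘ S₁⊆
  S₂⊆Q : S₂ ⊆ Q
  S₂⊆Q = p∩q⊆p Q A ∘ S₂⊆
  T₁⊆P : T₁ ⊆ P
  T₁⊆P = p─q⊆p P A ∘ T₁⊆
  T₂⊆Q : T₂ ⊆ Q
  T₂⊆Q = p─q⊆p Q A ∘ T₂⊆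

LinksQuadruples⇒meets-across : ∀ {m} {R : Rel (Fin N) 0ℓ} → LinksQuadruples m R →
  ∀ {P Q : Subset N} (A : Subset N) → Disjoint P Q → m ≤ ∣ P ∣ → m ≤ ∣ Q ∣ →
  m ≤ ∣ P ∩ A ∣ + ∣ Q ∩ A ∣ → m ≤ ∣ P ─ A ∣ + ∣ Q ─ A ∣ →
  Meets R (P ∩ A) (Q ─ A) ⊎ Meets R (Q ∩ A) (P ─ A)
LinksQuadruples⇒meets-across links {P} {Q} A P#Q m≤∣P∣ m≤∣Q∣ m≤∣P∩A∣+∣Q∩A∣ m≤∣P─A∣+∣Q─A∣
  with balanced-split (≤-trans m≤∣P∣ (≤-reflexive (∣p∣≡∣p∩q∣+∣p─q∣ P A)))
                      (≤-trans m≤∣Q∣ (≤-reflexive (∣p∣≡∣p∩q∣+∣p─q∣ Q A)))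
                      m≤∣P∩A∣+∣Q∩A∣ m≤∣P─A∣+∣Q─A∣
... | a , b , a+b≡m , a≤∣P∩A∣ , a≤∣Q─A∣ , b≤∣Q∩A∣ , b≤∣P─A∣
  with subset-of-size (P ∩ A) a≤∣P∩A∣ | subset-of-size (Q ∩ A) b≤∣Q∩A∣
     | subset-of-size (P ─ A) b≤∣P─A∣ | subset-of-size (Q ─ A) a≤∣Q─A∣
... | S₁ , S₁⊆ , ∣S₁∣≡a | S₂ , S₂⊆ , ∣S₂∣≡b | T₁ , T₁⊆ , ∣T₁∣≡b | T₂ , T₂⊆ , ∣T₂∣≡a =
  Sum.map (Meets-map id S₁⊆ T₂⊆) (Meets-map id S₂⊆ T₁⊆)
    (links S₁ S₂ T₁ T₂ (grid-balanced A P#Q a+b≡m S₁⊆ S₂⊆ T₁⊆ T₂⊆ ∣S₁∣≡a ∣S₂∣≡b ∣T₁∣≡b ∣T₂∣≡a))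

record DecSubgraph (G : Graph N) : Set₁ where
  field
    E     : Rel (Fin N) 0ℓ
    E?    : Decidable E
    E-sym : Symmetric E
    E⇒Adj : ∀ {u v} → E u v → Adj G u v

module _ {R : Rel (Fin N) 0ℓ} {S T S′ T′ : Subset N} where

  endpoints : Meets R S T ⊎ Meets R S′ T′ → Fin N × Fin N
  endpoints = [ (λ (u , v , _) → u , v) , (λ (u , v , _) → u , v) ]′

  endpoints-related : (r : Meets R S T ⊎ Meets R S′ T′) → uncurry R (endpoints r)
  endpoints-related (inj₁ (_ , _ , _ , _ , Ruv)) = Ruv
  endpoints-related (inj₂ (_ , _ , _ , _ , Ruv)) = Ruv

  endpoints-meet : (r : Meets R S T ⊎ Meets R S′ T′) →
    Meets (λ u v → endpoints r ≡ (u , v)) S T ⊎ Meets (λ u v → endpoints r ≡ (u , v)) S′ T′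
  endpoints-meet (inj₁ (u , v , u∈S , v∈T , _)) = inj₁ (u , v , u∈S , v∈T , refl)
  endpoints-meet (inj₂ (u , v , u∈S′ , v∈T′ , _)) = inj₂ (u , v , u∈S′ , v∈T′ , refl)

Disjoint? : ∀ (S T : Subset N) → Dec (Disjoint S T)
Disjoint? S T = all? λ x → x ∈? S →-dec ¬? (x ∈? T)

BalancedQuadruple? : ∀ m (S₁ S₂ T₁ T₂ : Subset N) → Dec (BalancedQuadruple m S₁ S₂ T₁ T₂)
BalancedQuadruple? m S₁ S₂ T₁ T₂ =
  Disjoint? S₁ S₂ ×-dec Disjoint? S₁ T₁ ×-dec Disjoint? S₁ T₂ ×-dec Disjoint? S₂ T₁ ×-dec
  Disjoint? S₂ T₂ ×-dec Disjoint? T₁ T₂ ×-dec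
  ∣ S₁ ∣ + ∣ S₂ ∣ ≟ m ×-dec ∣ T₁ ∣ + ∣ T₂ ∣ ≟ m ×-dec ∣ S₁ ∣ + ∣ T₁ ∣ ≟ m ×-dec ∣ S₂ ∣ + ∣ T₂ ∣ ≟ m

-- Adj G is not decidable, so the searches run on the subgraph of the edges that the
-- hypothesis returns for balanced quadruples: there are finitely many quadruples, so
-- it is decidable. Each query uses the proof found by BalancedQuadruple?, making the
-- answer a function of the quadruple alone.
module _ (G : Graph N) {m} (links : LinksQuadruples m (Adj G)) where

  private
    answer : ∀ {S₁ S₂ T₁ T₂} → Dec (BalancedQuadruple m S₁ S₂ T₁ T₂) → Maybe (Fin N × Fin N)
    answer (yes balanced) = just (endpoints (links _ _ _ _ balanced))
    answer (no _)         = nothing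

    answer-adjacent : ∀ {S₁ S₂ T₁ T₂ u v} (d : Dec (BalancedQuadruple m S₁ S₂ T₁ T₂)) →
      answer d ≡ just (u , v) → Adj G u v
    answer-adjacent (yes balanced) eq =
      subst (uncurry (Adj G)) (Maybe.just-injective eq) (endpoints-related (links _ _ _ _ balanced))

    answer-meets : ∀ {S₁ S₂ T₁ T₂} (d : Dec (BalancedQuadruple m S₁ S₂ T₁ T₂)) → BalancedQuadruple m S₁ S₂ T₁ T₂ →
      Meets (λ u v → answer d ≡ just (u , v)) S₁ T₂ ⊎ Meets (λ u v → answer d ≡ just (u , v)) S₂ T₁
    answer-meets (yes balanced) _ =
      Sum.map (Meets-map (cong just) id id) (Meets-map (cong just) id id) (endpoints-meet (links _ _ _ _ balanced))
    answer-meets (no unbalanced) balanced = contradiction balanced unbalanced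

    Answered : Rel (Fin N) 0ℓ
    Answered u v = ∃ λ S₁ → ∃ λ S₂ → ∃ λ T₁ → ∃ λ T₂ → answer (BalancedQuadruple? m S₁ S₂ T₁ T₂) ≡ just (u , v)

    Answered? : Decidable Answered
    Answered? u v = anySubset? λ S₁ → anySubset? λ S₂ → anySubset? λ T₁ → anySubset? λ T₂ →
      Maybe.≡-dec (Product.≡-dec _≟ᶠ_ _≟ᶠ_) (answer (BalancedQuadruple? m S₁ S₂ T₁ T₂)) (just (u , v))

    answered-subgraph : DecSubgraph G
    answered-subgraph = record
      { E     = λ u v → Answered u v ⊎ Answered v u
      ; E?    = λ u v → Answered? u v ⊎-dec Answered? v u
      ; E-sym = Sum.swap
      ; E⇒Adj = [ (λ (_ , _ , _ , _ , eq) → answer-adjacent (BalancedQuadruple? _ _ _ _ _) eq)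
                , (λ (_ , _ , _ , _ , eq) → Adj-sym G (answer-adjacent (BalancedQuadruple? _ _ _ _ _) eq)) ]′ }

  linking-dec-subgraph : Σ (DecSubgraph G) λ H → LinksQuadruples m (DecSubgraph.E H)
  linking-dec-subgraph = answered-subgraph , λ S₁ S₂ T₁ T₂ balanced →
    Sum.map (Meets-map (λ eq → inj₁ (S₁ , S₂ , T₁ , T₂ , eq)) id id)
            (Meets-map (λ eq → inj₁ (S₁ , S₂ , T₁ , T₂ , eq)) id id)
            (answer-meets (BalancedQuadruple? m S₁ S₂ T₁ T₂) balanced)
2m+2n≡2L+j+k⇒m<L : ∀ {m n L j k} → 2 * m + 2 * n ≡ 2 * L + j + k → j < n → k < n → m < L
2m+2n≡2L+j+k⇒m<L {m} {n} {L} {j} {k} sizes j<n k<n =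
  *-cancelˡ-< 2 m L (+-cancelʳ-< (2 * n) (2 * m) (2 * L) (begin-strict
    2 * m + 2 * n      ≡⟨ sizes ⟩
    2 * L + j + k      ≡⟨ +-assoc (2 * L) j k ⟩
    2 * L + (j + k)    <⟨ +-monoʳ-< (2 * L) (≤-trans (+-mono-< j<n k<n) (≤-reflexive n+n≡2n)) ⟩
    2 * L + 2 * n      ∎))
  where
  open ≤-Reasoning
  n+n≡2n : n + n ≡ 2 * n
  n+n≡2n = cong (n +_) (sym (+-identityʳ n))

2K≡2L+k⇒L≤a : ∀ {K L k a c} → 2 * K ≡ 2 * L + k → K ≤ a + c → 2 * c ≤ suc k → L ≤ a
2K≡2L+k⇒L≤a {K} {L} {k} {a} {c} sizes K≤a+c 2c≤1+k =
  s≤s⁻¹ (*-cancelˡ-< 2 L (suc a) (+-cancelʳ-< k (2 * L) (2 * suc a) (begin-strict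
    2 * L + k          ≡⟨ sizes ⟨
    2 * K              ≤⟨ *-monoʳ-≤ 2 K≤a+c ⟩
    2 * (a + c)        ≡⟨ *-distribˡ-+ 2 a c ⟩
    2 * a + 2 * c      ≤⟨ +-monoʳ-≤ (2 * a) 2c≤1+k ⟩
    2 * a + suc k      ≡⟨ +-suc (2 * a) k ⟩
    suc (2 * a + k)    <⟨ n<1+n _ ⟩
    2 + 2 * a + k      ≡⟨ cong (_+ k) (*-suc 2 a) ⟨
    2 * suc a + k      ∎)))
  where open ≤-Reasoning

-- The two searches

module TwoColouredPaths {G : Graph N} (H : DecSubgraph G) (χ : Colouring G) where
  open DecSubgraph H

  Red : Rel (Fin N) 0ℓ
  Red u v = E u v × col χ u v ≡ true

  Across : Subset N → Subset N → Rel (Fin N) 0ℓ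
  Across A B u v = u ∈ A × v ∈ B ⊎ u ∈ B × v ∈ A

  Blue : Subset N → Subset N → Rel (Fin N) 0ℓ
  Blue A B u v = E u v × col χ u v ≡ false × Across A B u v

  Red? : Decidable Red
  Red? u v = E? u v ×-dec col χ u v Bool.≟ true

  Red-sym : Symmetric Red
  Red-sym (Euv , red) = E-sym Euv , trans (colSym χ _ _) red

  Blue? : ∀ A B → Decidable (Blue A B)
  Blue? A B u v = E? u v ×-dec col χ u v Bool.≟ false ×-dec (u ∈? A ×-dec v ∈? B ⊎-dec u ∈? B ×-dec v ∈? A)

  Blue-sym : ∀ {A B} → Symmetric (Blue A B)
  Blue-sym (Euv , blue , across) = E-sym Euv , trans (colSym χ _ _) blue , Sum.swap (Sum.map swap swap across)

  Across-leaves : ∀ {A B} → Disjoint A B → ∀ {x y} → Across A B x y → x ∈ A → y ∉ A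
  Across-leaves A#B (inj₁ (_ , y∈B)) _   y∈A = A#B _ y∈A y∈B
  Across-leaves A#B (inj₂ (x∈B , _)) x∈A _   = A#B _ x∈A x∈B

  module RedSearch = DepthFirstSearch ⊤ Red? Red-sym
  module BlueSearch (A B : Subset N) = DepthFirstSearch (A ∪ B) (Blue? A B) Blue-sym

  module _ {m n} (2m+2n≡N : 2 * m + 2 * n ≡ N) (links : LinksQuadruples m E) (red : RedSearch.Separation n) where
    open RedSearch.Separation red using ()
      renaming (S to A; T to B; S#T to A#B; no-edge to no-red-edge; balanced to ∣A∣≡∣B∣;
                size to red-size; short to kR<n; k to kR)

    ∣A∣+∣B∣≡2∣A∣ : ∣ A ∣ + ∣ B ∣ ≡ 2 * ∣ A ∣
    ∣A∣+∣B∣≡2∣A∣ = cong (∣ A ∣ +_) (trans (sym ∣A∣≡∣B∣) (sym (+-identityʳ ∣ A ∣)))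

    red-sizes : 2 * m + 2 * n ≡ 2 * ∣ A ∣ + kR
    red-sizes = begin
      2 * m + 2 * n         ≡⟨ 2m+2n≡N ⟩
      N                     ≡⟨ ∣⊤∣≡n N ⟨
      ∣ ⊤ {N} ∣             ≡⟨ red-size ⟨
      ∣ A ∣ + ∣ B ∣ + kR    ≡⟨ cong (_+ kR) ∣A∣+∣B∣≡2∣A∣ ⟩
      2 * ∣ A ∣ + kR        ∎
      where open ≡-Reasoning

    no-blue-separation : ¬ BlueSearch.Separation A B n
    no-blue-separation blue =
      [ no-E-edge Q⊆A∪B (λ u∈P v∈Q → inj₁ (u∈P , v∈Q)) , no-E-edge P⊆A∪B (λ u∈Q v∈P → inj₂ (u∈Q , v∈P)) ]′
      (LinksQuadruples⇒meets-across links A P#Q m≤∣P∣ (≤-trans m≤∣P∣ (≤-reflexive ∣P∣≡∣Q∣))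
        (≤-trans m≤∣P∣ ∣P∣≤∣P∩A∣+∣Q∩A∣) (≤-trans m≤∣P∣ ∣P∣≤∣P─A∣+∣Q─A∣))
      where
      open BlueSearch.Separation A B blue using (path; covers; linked)
        renaming (S to P; T to Q; S⊆W to P⊆A∪B; T⊆W to Q⊆A∪B; S#T to P#Q; no-edge to no-blue-edge;
                  balanced to ∣P∣≡∣Q∣; size to blue-size; short to kB<n; k to kB)

      blue-sizes : 2 * ∣ A ∣ ≡ 2 * ∣ P ∣ + kB
      blue-sizes = begin
        2 * ∣ A ∣            ≡⟨ ∣A∣+∣B∣≡2∣A∣ ⟨
        ∣ A ∣ + ∣ B ∣        ≡⟨ Disjoint⇒∣p∪q∣≡∣p∣+∣q∣ A#B ⟨
        ∣ A ∪ B ∣            ≡⟨ blue-size ⟨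
        ∣ P ∣ + ∣ Q ∣ + kB   ≡⟨ cong (λ q → ∣ P ∣ + q + kB) (trans (sym ∣P∣≡∣Q∣) (sym (+-identityʳ ∣ P ∣))) ⟩
        2 * ∣ P ∣ + kB       ∎
        where open ≡-Reasoning

      m≤∣P∣ : m ≤ ∣ P ∣
      m≤∣P∣ = <⇒≤ (2m+2n≡2L+j+k⇒m<L (trans red-sizes (cong (_+ kR) blue-sizes)) kB<n kR<n)

      ─A⊆B : ∀ {C} → C ⊆ A ∪ B → C ─ A ⊆ B
      ─A⊆B {C} C⊆A∪B x∈C─A with x∈p─q⁻ C A x∈C─A
      ... | x∈C , x∉A = [ flip contradiction x∉A , id ]′ (x∈p∪q⁻ A B (C⊆A∪B x∈C))

      unseparated-on-path : ∀ {C} → C ⊆ A ∪ B → ∀ {x} → x ∈ C ─ P ─ Q → x ∈ C × x ∈ᵥ path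
      unseparated-on-path {C} C⊆A∪B x∈C─P─Q with x∈p─q⁻ (C ─ P) Q x∈C─P─Q
      ... | x∈C─P , x∉Q with x∈p─q⁻ C P x∈C─P
      ...   | x∈C , x∉P = x∈C , [ flip contradiction x∉P , [ flip contradiction x∉Q , id ]′ ]′ (covers (C⊆A∪B x∈C))

      ∣P∣≤∣P∩A∣+∣Q∩A∣ : ∣ P ∣ ≤ ∣ P ∩ A ∣ + ∣ Q ∩ A ∣
      ∣P∣≤∣P∩A∣+∣Q∩A∣ = 2K≡2L+k⇒L≤a blue-sizes
        (subst₂ (λ a b → ∣ A ∣ ≤ ∣ a ∣ + ∣ b ∣ + ∣ A ─ P ─ Q ∣) (∩-comm A P) (∩-comm A Q)
                (∣r∣≤∣r∩p∣+∣r∩q∣+∣r─p─q∣ A P Q))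
        (alternating-path-bound A (λ (_ , _ , across) → Across-leaves A#B across) linked (A ─ P ─ Q)
          (unseparated-on-path (p⊆p∪q B)))

      ∣P∣≤∣P─A∣+∣Q─A∣ : ∣ P ∣ ≤ ∣ P ─ A ∣ + ∣ Q ─ A ∣
      ∣P∣≤∣P─A∣+∣Q─A∣ = 2K≡2L+k⇒L≤a (trans (cong (2 *_) (sym ∣A∣≡∣B∣)) blue-sizes)
        (≤-trans (∣r∣≤∣r∩p∣+∣r∩q∣+∣r─p─q∣ B P Q) (+-monoˡ-≤ _ (+-mono-≤ (B∩C≤C─A P) (B∩C≤C─A Q))))
        (alternating-path-bound B (λ (_ , _ , across) → Across-leaves (Disjoint-sym A#B) (Sum.swap across))
          linked (B ─ P ─ Q)
          (unseparated-on-path (q⊆p∪q A B)))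
        where
        B∩C≤C─A : ∀ C → ∣ B ∩ C ∣ ≤ ∣ C ─ A ∣
        B∩C≤C─A C = p⊆q⇒∣p∣≤∣q∣ λ x∈B∩C → let x∈B , x∈C = x∈p∩q⁻ B C x∈B∩C in
          x∈p∧x∉q⇒x∈p─q x∈C λ x∈A → A#B _ x∈A x∈B

      no-E-across : ∀ {u v} → u ∈ A → v ∈ B → u ∈ P × v ∈ Q ⊎ u ∈ Q × v ∈ P → ¬ E u v
      no-E-across {u} {v} u∈A v∈B sides Euv with col χ u v in colour
      ... | true = no-red-edge u∈A v∈B (Euv , colour)
      ... | false with sides
      ...   | inj₁ (u∈P , v∈Q) = no-blue-edge u∈P v∈Q (Euv , colour , inj₁ (u∈A , v∈B))
      ...   | inj₂ (u∈Q , v∈P) = no-blue-edge v∈P u∈Q (Blue-sym (Euv , colour , inj₁ (u∈A , v∈B)))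

      no-E-edge : ∀ {X Y} → Y ⊆ A ∪ B → (∀ {u v} → u ∈ X → v ∈ Y → u ∈ P × v ∈ Q ⊎ u ∈ Q × v ∈ P) →
        ¬ Meets E (X ∩ A) (Y ─ A)
      no-E-edge {X} {Y} Y⊆A∪B sides (u , v , u∈X∩A , v∈Y─A , Euv) =
        let u∈X , u∈A = x∈p∩q⁻ X A u∈X∩A
        in no-E-across u∈A (─A⊆B Y⊆A∪B v∈Y─A) (sides u∈X (p─q⊆p Y A v∈Y─A)) Euv

  monochromatic-path : ∀ {m n} → 2 * m + 2 * n ≡ N → LinksQuadruples m E → ∃ λ b → MonoPath G χ b n
  monochromatic-path {n = n} 2m+2n≡N links with RedSearch.dfs n
  ... | inj₁ red-path = true , Path⇒MonoPath χ (λ (Euv , red) → E⇒Adj Euv , red) red-path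
  ... | inj₂ red with BlueSearch.dfs (RedSearch.Separation.S red) (RedSearch.Separation.T red) n
  ...   | inj₁ blue-path = false , Path⇒MonoPath χ (λ (Euv , blue , _) → E⇒Adj Euv , blue) blue-path
  ...   | inj₂ blue = contradiction blue (no-blue-separation 2m+2n≡N links red)

lemma3p4 : (N n m : ℕ) → 2 * n < N → 2 * m + 2 * n ≡ N → (G : Graph N) →
    (∀ (S₁ S₂ T₁ T₂ : Subset N) →
      Disjoint S₁ S₂ → Disjoint S₁ T₁ → Disjoint S₁ T₂ →
      Disjoint S₂ T₁ → Disjoint S₂ T₂ → Disjoint T₁ T₂ →
      ∣ S₁ ∣ + ∣ S₂ ∣ ≡ m → ∣ T₁ ∣ + ∣ T₂ ∣ ≡ m →
      ∣ S₁ ∣ + ∣ T₁ ∣ ≡ m → ∣ S₂ ∣ + ∣ T₂ ∣ ≡ m →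
      EdgeBetween G S₁ T₂ ⊎ EdgeBetween G S₂ T₁) →
    Arrows G n
lemma3p4 N n m _ 2m+2n≡N G links χ =
  let H , E-links = linking-dec-subgraph G λ S₁ S₂ T₁ T₂ (d₁ , d₂ , d₃ , d₄ , d₅ , d₆ , e₁ , e₂ , e₃ , e₄) →
                      links S₁ S₂ T₁ T₂ d₁ d₂ d₃ d₄ d₅ d₆ e₁ e₂ e₃ e₄
  in TwoColouredPaths.monochromatic-path H χ 2m+2n≡N E-links
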